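{- Let $\lambda$ be a nonzero real number. Define the degenerate B-algorithm matrix $(a_{n,m}(\lambda))_{n,m\ge0}$ by $a_{0,m}(\lambda)=\frac{\binom{m-\lambda}{m}}{m+1}$ for $m\ge0$ and \[ a_{n,m}(\lambda)=\big(m-(n-1)\lambda\big)a_{n-1,m}(\lambda)-(m+1)a_{n-1,m+1}(\lambda),\qquad n\ge1,\ m\ge0. \] Then for every $n\ge0$, \[ a_{n,0}(\lambda)=\sum_{k=0}^{n}(-1)^{k}k!\,{n \brace k}_{\lambda}\frac{\binom{k-\lambda}{k}}{k+1}=\beta_{n,\lambda}, \] and \[ \sum_{k=0}^{n}S_{1,\lambda}(n,k)\,\beta_{k,\lambda}=(-1)^{n}\frac{(n-\lambda)_{n}}{n+1}. \]
   Context: For $n\ge0$ set $(x)_{0,\lambda}=1$, $(x)_{n,\lambda}=x(x-\lambda)\cdots(x-(n-1)\lambda)$ for $n\ge1$, and $(x)_0=1$, $(x)_n=x(x-1)\cdots(x-n+1)$ for $n\ge1$; $\binom{k-\lambda}{k}=(k-\lambda)_k/k!$. The degenerate exponential is $e_\lambda(t)=\sum_{k\ge0}(1)_{k,\lambda}\frac{t^k}{k!}$ (i.e. $(1+\lambda t)^{1/\lambda}$), and $\log_\lambda$ is its compositional inverse, so $\log_\lambda(1+t)=\sum_{n\ge1}\frac{(-1)^{n-1}}{n}\binom{n-1-\lambda}{n-1}t^n$. The degenerate Stirling numbers of the second kind ${n \brace k}_{\lambda}$ are defined by $(x)_{n,\lambda}=\sum_{k=0}^{n}{n \brace k}_{\lambda}(x)_{k}$;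 the degenerate Stirling numbers of the first kind $S_{1,\lambda}(n,k)$ are defined by $\frac{1}{k!}(\log_\lambda(1+t))^k=\sum_{n\ge k}S_{1,\lambda}(n,k)\frac{t^n}{n!}$ (with $S_{1,\lambda}(n,k)=0$ for $n<k$). The degenerate Bernoulli numbers are defined by $\frac{t}{e_\lambda(t)-1}=\sum_{n\ge0}\beta_{n,\lambda}\frac{t^n}{n!}$. -}

module Defs where

open import Level using (Level; _⊔_) renaming (suc to lsuc)
open import Algebra.Bundles using (CommutativeRing)
open import Data.Nat using (ℕ; zero; suc; _∸_)
open import Relation.Nullary using (¬_)

embℕ : ∀ {c ℓ} (R : CommutativeRing c ℓ) → ℕ → CommutativeRing.Carrier R
embℕ R zero    = CommutativeRing.0# R
embℕ R (suc n) = CommutativeRing._+_ R (CommutativeRing.1# R) (embℕ R n)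

-- A field of characteristic zero (e.g. the real numbers):
-- a commutative ring in which every nonzero element has an inverse and
-- (n+1)·1 ≠ 0 for all n (in particular 1 ≠ 0).
record CharZeroField (c ℓ : Level) : Set (lsuc (c ⊔ ℓ)) where
  field
    commRing : CommutativeRing c ℓ
  open CommutativeRing commRing
  field
    inv      : (x : Carrier) → ¬ (x ≈ 0#) → Carrier
    inverse  : ∀ x (p : ¬ (x ≈ 0#)) → (x * inv x p) ≈ 1#
    charZero : ∀ n → ¬ (embℕ commRing (suc n) ≈ 0#)

module CZF {c ℓ} (F : CharZeroField c ℓ) where
  open CharZeroField F public
  open CommutativeRing commRing public

  ι : ℕ → Carrier
  ι = embℕ commRing

  _/suc_ : Carrier → ℕ → Carrier
  x /suc n = x * inv (ι (suc n)) (charZero n)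

  fact : ℕ → ℕ
  fact zero    = 1
  fact (suc n) = suc n Data.Nat.* fact n

  -- x / n!   (n! = suc (n! - 1) is nonzero)
  _/fact_ : Carrier → ℕ → Carrier
  x /fact n = x /suc (fact n ∸ 1)

  -- x / n  for n ≥ 1 (value irrelevant / 0 for n = 0)
  _/ℕ_ : Carrier → ℕ → Carrier
  x /ℕ zero    = 0#
  x /ℕ (suc n) = x /suc n

  sgn : ℕ → Carrier
  sgn zero    = 1#
  sgn (suc n) = - (sgn n)

  sumTo : ℕ → (ℕ → Carrier) → Carrier
  sumTo zero    f = f 0
  sumTo (suc n) f = sumTo n f + f (suc n)

  dfall : Carrier → Carrier → ℕ → Carrier
  dfall x l zero    = 1#
  dfall x l (suc n) = dfall x l n * (x - ι n * l)

  fall : Carrier → ℕ → Carrier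
  fall x n = dfall x 1# n

  binomλ : Carrier → ℕ → Carrier
  binomλ l k = fall (ι k - l) k /fact k

  amat : Carrier → ℕ → ℕ → Carrier
  amat l zero    m = binomλ l m /suc m
  amat l (suc n) m = ((ι m - ι n * l) * amat l n m) - (ι (suc m) * amat l n (suc m))

  -- formal power series as coefficient sequences; Cauchy product
  _⋆_ : (ℕ → Carrier) → (ℕ → Carrier) → (ℕ → Carrier)
  (f ⋆ g) n = sumTo n (λ i → f i * g (n ∸ i))

  spow : (ℕ → Carrier) → ℕ → (ℕ → Carrier)
  spow f zero zero    = 1#
  spow f zero (suc n) = 0#
  spow f (suc k)      = f ⋆ spow f k

  -- coefficients of log_λ(1+t) = Σ_{n≥1} (-1)^{n-1}/n · binom(n-1-λ, n-1) t^n
  logλ : Carrier → ℕ → Carrier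
  logλ l zero    = 0#
  logλ l (suc n) = (sgn n * binomλ l n) /suc n

  -- degenerate Stirling numbers of the first kind:
  -- (1/k!) (log_λ(1+t))^k = Σ_n S1_λ(n,k) t^n/n!, i.e.
  -- S1_λ(n,k) = n! · [t^n] (log_λ(1+t))^k / k!
  S1 : Carrier → ℕ → ℕ → Carrier
  S1 l n k = ι (fact n) * (spow (logλ l) k n /fact k)

  -- coefficients of e_λ(t) - 1 = Σ_{n≥1} (1)_{n,λ} t^n/n!
  eλm1 : Carrier → ℕ → Carrier
  eλm1 l zero    = 0#
  eλm1 l (suc n) = dfall 1# l (suc n) /fact (suc n)

  -- β is the sequence of degenerate Bernoulli numbers:
  -- Σ β_n t^n/n! is the power series t/(e_λ(t)-1), i.e. the series B with
  -- (e_λ(t)-1) · B(t) = t.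
  IsDegBernoulli : Carrier → (ℕ → Carrier) → Set ℓ
  IsDegBernoulli l β =
    ∀ n → (eλm1 l ⋆ (λ k → β k /fact k)) n ≈ (δ1 n)
    where
      δ1 : ℕ → Carrier
      δ1 (suc zero) = 1#
      δ1 _          = 0#

  IsDegStirling2 : Carrier → (ℕ → ℕ → Carrier) → Set (c ⊔ ℓ)
  IsDegStirling2 l S2 = ∀ n x → dfall x l n ≈ sumTo n (λ k → S2 n k * fall x k)

{-# OPTIONS --safe #-}
-- With Q = t - 1 and D = d/dt the
-- B-algorithm step is a ↦ (Q D - nλ) a, while (Q D - k)(Qᵏ Dᵏ b) = Qᵏ⁺¹ Dᵏ⁺¹ b.  So the same triangular
-- recurrence that expands (x)_{n,λ} in falling factorials expands a_n = Σₖ S2(n,k) Qᵏ Dᵏ a₀, whose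
-- constant term is Σₖ (-1)ᵏ k! S2(n,k) a₀ₖ.  For L = log_λ(1+t) one has (1+t) L′ = 1 + λL, which gives the
-- recurrence of S1 and hence (x)_n = Σₖ S1(n,k) (x)_{k,λ}; at x = 1 this says e_λ(L) - 1 = t.
-- Substituting L into (e_λ(t) - 1) B(t) = t therefore gives B(L) = L / t, i.e.
-- Σₖ S1(n,k) βₖ = n! [t^{n+1}] L.  Finally S2 and S1 are inverse triangles, because the (x)_{k,λ} are
-- linearly independent when λ ≠ 0, and this turns the second identity into β_n = Σₖ (-1)ᵏ k! S2(n,k) a₀ₖ.
module Submission where

open import Defs
open import Level using (Level)
open import Algebra.Bundles using (CommutativeRing)
open import Data.Nat as ℕ using (ℕ; zero; suc; _∸_; _≤_; _<_; z≤n; s≤s)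
import Data.Nat.Properties as ℕ
open import Data.Integer as ℤ using (ℤ; +_; -[1+_]; _⊖_; 0ℤ; 1ℤ)
import Data.Integer.Properties as ℤ
open import Data.Sign as Sign using (Sign)
open import Data.Maybe using (Maybe; just; nothing)
open import Data.Product using (_×_; _,_)
open import Data.Empty using (⊥-elim)
open import Data.Sum using (inj₁; inj₂)
open import Function using (_∘_)
open import Relation.Nullary using (¬_; yes; no)
open import Relation.Binary.Definitions using (tri<; tri≈; tri>)
open import Data.Nat.Induction using (<-rec)
open import Relation.Binary.PropositionalEquality as ≡ using (_≡_; _≢_)

-- R need not have decidable equality, so the ring solver works with integer coefficients mapped into R.
module IntegerCoefficientSolver {c ℓ} (R : CommutativeRing c ℓ) where
  open CommutativeRing R
  open import Algebra.Properties.Ring ring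
    using (-‿involutive; -‿distribˡ-*; -‿distribʳ-*; -‿+-comm; -0#≈0#)
  open import Algebra.Properties.Semiring.Mult.TCOptimised semiring
    renaming (_×_ to _×′_) using (×-homo-+; ×1-homo-*)
  open import Algebra.Solver.Ring.AlmostCommutativeRing
    using (fromCommutativeRing; _-Raw-AlmostCommutative⟶_)
  open import Relation.Binary.Reasoning.Setoid setoid

  private
    -- `_×′_` is the type-checking-optimised multiple, for which `1 ×′ 1#` is
    -- literally `1#`: so the solver constant `con 1ℤ` denotes `1#` itself.
    ⟦_⟧ : ℤ → Carrier
    ⟦ + n ⟧    = n ×′ 1#
    ⟦ -[1+ n ] ⟧ = - (suc n ×′ 1#)

    signed : Sign → Carrier → Carrier
    signed Sign.+ x = x
    signed Sign.- x = - x

    ⟦⟧-signed : ∀ i → ⟦ i ⟧ ≈ signed (ℤ.sign i) (ℤ.∣ i ∣ ×′ 1#)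
    ⟦⟧-signed (+ n)    = refl
    ⟦⟧-signed -[1+ n ] = refl

    ⟦◃⟧ : ∀ s n → ⟦ s ℤ.◃ n ⟧ ≈ signed s (n ×′ 1#)
    ⟦◃⟧ Sign.+ zero    = refl
    ⟦◃⟧ Sign.- zero    = sym -0#≈0#
    ⟦◃⟧ Sign.+ (suc n) = refl
    ⟦◃⟧ Sign.- (suc n) = refl

    signed-cong : ∀ s {x y} → x ≈ y → signed s x ≈ signed s y
    signed-cong Sign.+ x≈y = x≈y
    signed-cong Sign.- x≈y = -‿cong x≈y

    signed-* : ∀ s t x y → signed (s Sign.* t) (x * y) ≈ signed s x * signed t y
    signed-* Sign.+ Sign.+ x y = refl
    signed-* Sign.+ Sign.- x y = -‿distribʳ-* x y
    signed-* Sign.- Sign.+ x y = -‿distribˡ-* x y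
    signed-* Sign.- Sign.- x y = begin
      x * y           ≈⟨ -‿involutive (x * y) ⟨
      - - (x * y)     ≈⟨ -‿cong (-‿distribʳ-* x y) ⟩
      - (x * - y)     ≈⟨ -‿distribˡ-* x (- y) ⟩
      - x * - y       ∎

    suc×1 : ∀ n → suc n ×′ 1# ≈ 1# + n ×′ 1#
    suc×1 n = ×-homo-+ 1# 1 n

    ⟦⊖⟧ : ∀ m n → ⟦ m ⊖ n ⟧ ≈ m ×′ 1# - n ×′ 1#
    ⟦⊖⟧ zero    zero    = sym (-‿inverseʳ 0#)
    ⟦⊖⟧ (suc m) zero    = sym (trans (+-congˡ -0#≈0#) (+-identityʳ _))
    ⟦⊖⟧ zero    (suc n) = sym (+-identityˡ _)
    ⟦⊖⟧ (suc m) (suc n) = begin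
      ⟦ suc m ⊖ suc n ⟧              ≡⟨ ≡.cong ⟦_⟧ (ℤ.[1+m]⊖[1+n]≡m⊖n m n) ⟩
      ⟦ m ⊖ n ⟧                      ≈⟨ ⟦⊖⟧ m n ⟩
      a - b                          ≈⟨ +-identityˡ (a - b) ⟨
      0# + (a - b)                   ≈⟨ +-congʳ (-‿inverseʳ 1#) ⟨
      (1# - 1#) + (a - b)            ≈⟨ +-assoc 1# (- 1#) (a - b) ⟩
      1# + (- 1# + (a - b))          ≈⟨ +-congˡ (+-assoc (- 1#) a (- b)) ⟨
      1# + ((- 1# + a) - b)          ≈⟨ +-congˡ (+-congʳ (+-comm (- 1#) a)) ⟩
      1# + ((a - 1#) - b)            ≈⟨ +-congˡ (+-assoc a (- 1#) (- b)) ⟩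
      1# + (a + (- 1# - b))          ≈⟨ +-congˡ (+-congˡ (-‿+-comm 1# b)) ⟩
      1# + (a - (1# + b))            ≈⟨ +-assoc 1# a (- (1# + b)) ⟨
      (1# + a) - (1# + b)            ≈⟨ +-cong (suc×1 m) (-‿cong (suc×1 n)) ⟨
      suc m ×′ 1# - suc n ×′ 1#        ∎
      where a = m ×′ 1#; b = n ×′ 1#

    +-homo : ∀ i j → ⟦ i ℤ.+ j ⟧ ≈ ⟦ i ⟧ + ⟦ j ⟧
    +-homo (+ m)    (+ n)    = ×-homo-+ 1# m n
    +-homo (+ m)    -[1+ n ] = ⟦⊖⟧ m (suc n)
    +-homo -[1+ m ] (+ n)    = trans (⟦⊖⟧ n (suc m)) (+-comm _ _)
    +-homo -[1+ m ] -[1+ n ] = begin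
      - (suc (suc (m ℕ.+ n)) ×′ 1#)          ≡⟨ ≡.cong (λ k → - (suc k ×′ 1#)) (ℕ.+-suc m n) ⟨
      - ((suc m ℕ.+ suc n) ×′ 1#)            ≈⟨ -‿cong (×-homo-+ 1# (suc m) (suc n)) ⟩
      - (suc m ×′ 1# + suc n ×′ 1#)           ≈⟨ -‿+-comm _ _ ⟨
      - (suc m ×′ 1#) - (suc n ×′ 1#)         ∎

    *-homo : ∀ i j → ⟦ i ℤ.* j ⟧ ≈ ⟦ i ⟧ * ⟦ j ⟧
    *-homo i j = begin
      ⟦ (s Sign.* t) ℤ.◃ (∣i∣ ℕ.* ∣j∣) ⟧                 ≈⟨ ⟦◃⟧ (s Sign.* t) (∣i∣ ℕ.* ∣j∣) ⟩
      signed (s Sign.* t) ((∣i∣ ℕ.* ∣j∣) ×′ 1#)           ≈⟨ signed-cong (s Sign.* t) (×1-homo-* ∣i∣ ∣j∣) ⟩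
      signed (s Sign.* t) ((∣i∣ ×′ 1#) * (∣j∣ ×′ 1#))      ≈⟨ signed-* s t _ _ ⟩
      signed s (∣i∣ ×′ 1#) * signed t (∣j∣ ×′ 1#)          ≈⟨ *-cong (⟦⟧-signed i) (⟦⟧-signed j) ⟨
      ⟦ i ⟧ * ⟦ j ⟧                                      ∎
      where s = ℤ.sign i; t = ℤ.sign j; ∣i∣ = ℤ.∣ i ∣; ∣j∣ = ℤ.∣ j ∣

    -‿homo : ∀ i → ⟦ ℤ.- i ⟧ ≈ - ⟦ i ⟧
    -‿homo (+ zero)  = sym -0#≈0#
    -‿homo (+ suc n) = refl
    -‿homo -[1+ n ]  = sym (-‿involutive _)

    homomorphism : ℤ.+-*-rawRing -Raw-AlmostCommutative⟶ fromCommutativeRing R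
    homomorphism = record
      { ⟦_⟧ = ⟦_⟧ ; +-homo = +-homo ; *-homo = *-homo ; -‿homo = -‿homo
      ; 0-homo = refl ; 1-homo = refl }

    ⟦⟧-≟ : ∀ i j → Maybe (⟦ i ⟧ ≈ ⟦ j ⟧)
    ⟦⟧-≟ i j with i ℤ.≟ j
    ... | yes ≡.refl = just refl
    ... | no _       = nothing

  open import Algebra.Solver.Ring ℤ.+-*-rawRing (fromCommutativeRing R) homomorphism ⟦⟧-≟ public

module _ {c ℓ : Level} (F : CharZeroField c ℓ) where
  open CZF F
  open import Algebra.Properties.Ring ring using (-0#≈0#; -‿+-comm; -‿distribˡ-*; x∙y⁻¹≈ε⇒x≈y)
  open import Relation.Binary.Reasoning.Setoid setoid
  open IntegerCoefficientSolver commRing using (solve; _:=_; _:+_; _:*_; _:-_; :-_; con)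

  ι-+ : ∀ m n → ι (m ℕ.+ n) ≈ ι m + ι n
  ι-+ zero    n = sym (+-identityˡ _)
  ι-+ (suc m) n = trans (+-congˡ (ι-+ m n)) (sym (+-assoc _ _ _))

  ι-* : ∀ m n → ι (m ℕ.* n) ≈ ι m * ι n
  ι-* zero    n = sym (zeroˡ _)
  ι-* (suc m) n = begin
    ι (n ℕ.+ m ℕ.* n)          ≈⟨ trans (ι-+ n (m ℕ.* n)) (+-congˡ (ι-* m n)) ⟩
    ι n + ι m * ι n            ≈⟨ solve 2 (λ a b → b :+ a :* b := (con 1ℤ :+ a) :* b) refl (ι m) (ι n) ⟩
    (1# + ι m) * ι n           ∎

  ι-∸ : ∀ {m n} → n ≤ m → ι (m ∸ n) ≈ ι m - ι n
  ι-∸ {m} {n} n≤m = begin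
    ι (m ∸ n)                  ≈⟨ solve 2 (λ a b → a := (a :+ b) :- b) refl (ι (m ∸ n)) (ι n) ⟩
    (ι (m ∸ n) + ι n) - ι n    ≈⟨ +-congʳ (sym (ι-+ (m ∸ n) n)) ⟩
    ι (m ∸ n ℕ.+ n) - ι n      ≡⟨ ≡.cong (λ k → ι k - ι n) (ℕ.m∸n+n≡m n≤m) ⟩
    ι m - ι n                  ∎

  1#≉0# : ¬ (1# ≈ 0#)
  1#≉0# 1≈0 = charZero 0 (trans (+-congʳ 1≈0) (+-identityˡ 0#))

  *-cancelʳ-≉0 : ∀ {x y} → ¬ (y ≈ 0#) → x * y ≈ 0# → x ≈ 0#
  *-cancelʳ-≉0 {x} {y} y≉0 xy≈0 = begin
    x                          ≈⟨ sym (*-identityʳ x) ⟩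
    x * 1#                     ≈⟨ *-congˡ (sym (inverse y y≉0)) ⟩
    x * (y * inv y y≉0)        ≈⟨ sym (*-assoc _ _ _) ⟩
    (x * y) * inv y y≉0        ≈⟨ *-congʳ xy≈0 ⟩
    0# * inv y y≉0             ≈⟨ zeroˡ _ ⟩
    0#                         ∎

  *-≉0 : ∀ {x y} → ¬ (x ≈ 0#) → ¬ (y ≈ 0#) → ¬ (x * y ≈ 0#)
  *-≉0 x≉0 y≉0 xy≈0 = x≉0 (*-cancelʳ-≉0 y≉0 xy≈0)

  /suc-inverseʳ : ∀ x n → (x /suc n) * ι (suc n) ≈ x
  /suc-inverseʳ x n = begin
    x * i * ι (suc n)          ≈⟨ *-assoc _ _ _ ⟩
    x * (i * ι (suc n))        ≈⟨ *-congˡ (trans (*-comm _ _) (inverse _ (charZero n))) ⟩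
    x * 1#                     ≈⟨ *-identityʳ x ⟩
    x                          ∎
    where i = inv (ι (suc n)) (charZero n)

  /suc-unique : ∀ {x y} n → y * ι (suc n) ≈ x → y ≈ x /suc n
  /suc-unique {x} {y} n y*n+1≈x = begin
    y                          ≈⟨ sym (*-identityʳ y) ⟩
    y * 1#                     ≈⟨ *-congˡ (sym (inverse _ (charZero n))) ⟩
    y * (ι (suc n) * i)        ≈⟨ sym (*-assoc _ _ _) ⟩
    (y * ι (suc n)) * i        ≈⟨ *-congʳ y*n+1≈x ⟩
    x /suc n                   ∎
    where i = inv (ι (suc n)) (charZero n)

  /suc-zero : ∀ x → x /suc 0 ≈ x
  /suc-zero x = trans (sym (trans (*-congˡ (+-identityʳ 1#)) (*-identityʳ _))) (/suc-inverseʳ x 0)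

  suc[fact∸1]≡fact : ∀ n → suc (fact n ∸ 1) ≡ fact n
  suc[fact∸1]≡fact zero = ≡.refl
  suc[fact∸1]≡fact (suc n) with fact n | suc[fact∸1]≡fact n
  ... | suc _ | ≡.refl = ≡.refl

  /fact-inverseʳ : ∀ x n → (x /fact n) * ι (fact n) ≈ x
  /fact-inverseʳ x n = begin
    (x /fact n) * ι (fact n)                       ≡⟨ ≡.cong (λ k → (x /fact n) * ι k) (suc[fact∸1]≡fact n) ⟨
    (x /suc (fact n ∸ 1)) * ι (suc (fact n ∸ 1))   ≈⟨ /suc-inverseʳ x (fact n ∸ 1) ⟩
    x                                              ∎

  /fact-unique : ∀ {x y} n → y * ι (fact n) ≈ x → y ≈ x /fact n
  /fact-unique {x} {y} n y*n!≈x = /suc-unique (fact n ∸ 1) (begin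
    y * ι (suc (fact n ∸ 1))   ≡⟨ ≡.cong (λ k → y * ι k) (suc[fact∸1]≡fact n) ⟩
    y * ι (fact n)             ≈⟨ y*n!≈x ⟩
    x                          ∎)

  /fact-suc : ∀ x n → (x /fact (suc n)) * ι (suc n) ≈ x /fact n
  /fact-suc x n = /fact-unique n (begin
    (x /fact (suc n)) * ι (suc n) * ι (fact n)     ≈⟨ *-assoc _ _ _ ⟩
    (x /fact (suc n)) * (ι (suc n) * ι (fact n))   ≈⟨ *-congˡ (sym (ι-* (suc n) (fact n))) ⟩
    (x /fact (suc n)) * ι (fact (suc n))           ≈⟨ /fact-inverseʳ x (suc n) ⟩
    x                                              ∎)

  sumTo-cong-≤ : ∀ n {f g : ℕ → Carrier} → (∀ i → i ≤ n → f i ≈ g i) → sumTo n f ≈ sumTo n g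
  sumTo-cong-≤ zero    f≈g = f≈g 0 z≤n
  sumTo-cong-≤ (suc n) f≈g = +-cong (sumTo-cong-≤ n (λ i i≤n → f≈g i (ℕ.m≤n⇒m≤1+n i≤n))) (f≈g (suc n) ℕ.≤-refl)

  sumTo-cong : ∀ n {f g : ℕ → Carrier} → (∀ i → f i ≈ g i) → sumTo n f ≈ sumTo n g
  sumTo-cong n f≈g = sumTo-cong-≤ n (λ i _ → f≈g i)

  sumTo-distrib-+ : ∀ n (f g : ℕ → Carrier) → sumTo n (λ i → f i + g i) ≈ sumTo n f + sumTo n g
  sumTo-distrib-+ zero    f g = refl
  sumTo-distrib-+ (suc n) f g = trans (+-congʳ (sumTo-distrib-+ n f g))
    (solve 4 (λ a b c d → (a :+ b) :+ (c :+ d) := (a :+ c) :+ (b :+ d)) refl _ _ _ _)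

  *-distribˡ-sumTo : ∀ n x (f : ℕ → Carrier) → x * sumTo n f ≈ sumTo n (λ i → x * f i)
  *-distribˡ-sumTo zero    x f = refl
  *-distribˡ-sumTo (suc n) x f = trans (distribˡ _ _ _) (+-congʳ (*-distribˡ-sumTo n x f))

  *-distribʳ-sumTo : ∀ n x (f : ℕ → Carrier) → sumTo n f * x ≈ sumTo n (λ i → f i * x)
  *-distribʳ-sumTo zero    x f = refl
  *-distribʳ-sumTo (suc n) x f = trans (distribʳ _ _ _) (+-congʳ (*-distribʳ-sumTo n x f))

  -‿distrib-sumTo : ∀ n (f : ℕ → Carrier) → - sumTo n f ≈ sumTo n (λ i → - f i)
  -‿distrib-sumTo zero    f = refl
  -‿distrib-sumTo (suc n) f = trans (sym (-‿+-comm _ _)) (+-congʳ (-‿distrib-sumTo n f))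

  sumTo-zero : ∀ n (f : ℕ → Carrier) → (∀ i → i ≤ n → f i ≈ 0#) → sumTo n f ≈ 0#
  sumTo-zero zero    f f≈0 = f≈0 0 z≤n
  sumTo-zero (suc n) f f≈0 = trans
    (+-cong (sumTo-zero n f (λ i i≤n → f≈0 i (ℕ.m≤n⇒m≤1+n i≤n))) (f≈0 (suc n) ℕ.≤-refl))
    (+-identityˡ 0#)

  sumTo-head : ∀ n (f : ℕ → Carrier) → sumTo (suc n) f ≈ f 0 + sumTo n (λ i → f (suc i))
  sumTo-head zero    f = refl
  sumTo-head (suc n) f = trans (+-congʳ (sumTo-head n f)) (+-assoc _ _ _)

  sumTo-extend : ∀ {m n} (f : ℕ → Carrier) → m ≤ n → (∀ i → m < i → f i ≈ 0#) → sumTo n f ≈ sumTo m f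
  sumTo-extend {m} {n} f m≤n f≈0 with ℕ.m≤n⇒m<n∨m≡n m≤n
  ... | inj₂ ≡.refl = refl
  sumTo-extend {m} {suc n} f m≤n f≈0 | inj₁ m<1+n = begin
    sumTo n f + f (suc n)      ≈⟨ +-cong (sumTo-extend f (ℕ.≤-pred m<1+n) f≈0) (f≈0 (suc n) m<1+n) ⟩
    sumTo m f + 0#             ≈⟨ +-identityʳ _ ⟩
    sumTo m f                  ∎

  sumTo-comm : ∀ m n (f : ℕ → ℕ → Carrier) →
    sumTo m (λ i → sumTo n (λ j → f i j)) ≈ sumTo n (λ j → sumTo m (λ i → f i j))
  sumTo-comm zero    n f = refl
  sumTo-comm (suc m) n f = trans (+-congʳ (sumTo-comm m n f)) (sym (sumTo-distrib-+ n _ _))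

  sumTo-*-sumTo : ∀ m n (f g : ℕ → Carrier) → sumTo m f * sumTo n g ≈ sumTo m (λ i → sumTo n (λ j → f i * g j))
  sumTo-*-sumTo m n f g = trans (*-distribʳ-sumTo m _ f) (sumTo-cong m (λ i → *-distribˡ-sumTo n (f i) g))

  sumTo-reverse : ∀ n (f : ℕ → Carrier) → sumTo n f ≈ sumTo n (λ i → f (n ∸ i))
  sumTo-reverse zero    f = refl
  sumTo-reverse (suc n) f = begin
    sumTo (suc n) f                                   ≈⟨ trans (sumTo-head n f) (+-comm _ _) ⟩
    sumTo n (λ i → f (suc i)) + f 0                   ≈⟨ +-congʳ (sumTo-reverse n (λ i → f (suc i))) ⟩
    sumTo n (λ i → f (suc (n ∸ i))) + f 0
      ≈⟨ +-cong (sumTo-cong-≤ n (λ i i≤n → reflexive (≡.cong f (≡.sym (ℕ.+-∸-assoc 1 i≤n)))))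
                                                                (reflexive (≡.cong f (≡.sym (ℕ.n∸n≡0 n)))) ⟩
    sumTo n (λ i → f (suc n ∸ i)) + f (suc n ∸ suc n) ∎

  sumTo-triangle : ∀ n (g : ℕ → ℕ → Carrier) →
    sumTo n (λ k → sumTo k (λ i → g i (k ∸ i))) ≈ sumTo n (λ i → sumTo (n ∸ i) (λ j → g i j))
  sumTo-triangle zero    g = refl
  sumTo-triangle (suc n) g = begin
    sumTo n (λ k → sumTo k (λ i → g i (k ∸ i))) + sumTo (suc n) (λ i → g i (suc n ∸ i))
      ≈⟨ +-congʳ (sumTo-triangle n g) ⟩
    sumTo n (λ i → sumTo (n ∸ i) (g i)) + (sumTo n (λ i → g i (suc n ∸ i)) + g (suc n) (suc n ∸ suc n))
      ≈⟨ sym (+-assoc _ _ _) ⟩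
    (sumTo n (λ i → sumTo (n ∸ i) (g i)) + sumTo n (λ i → g i (suc n ∸ i))) + g (suc n) (suc n ∸ suc n)
      ≈⟨ +-cong (sym (sumTo-distrib-+ n _ _)) (reflexive (≡.cong (g (suc n)) (ℕ.n∸n≡0 n))) ⟩
    sumTo n (λ i → sumTo (n ∸ i) (g i) + g i (suc n ∸ i)) + g (suc n) 0
      ≈⟨ +-congʳ (sumTo-cong-≤ n (λ i i≤n → reflexive (absorb i (ℕ.+-∸-assoc 1 i≤n)))) ⟩
    sumTo n (λ i → sumTo (suc n ∸ i) (g i)) + g (suc n) 0
      ≡⟨ ≡.cong (λ k → sumTo n (λ i → sumTo (suc n ∸ i) (g i)) + sumTo k (g (suc n))) (ℕ.n∸n≡0 n) ⟨
    sumTo n (λ i → sumTo (suc n ∸ i) (g i)) + sumTo (suc n ∸ suc n) (g (suc n)) ∎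
    where
    absorb : ∀ i {k} → k ≡ suc (n ∸ i) → sumTo (n ∸ i) (g i) + g i k ≡ sumTo k (g i)
    absorb i ≡.refl = ≡.refl

  sumTo-single : ∀ n k (f : ℕ → Carrier) → k ≤ n → (∀ i → i ≤ n → i ≢ k → f i ≈ 0#) → sumTo n f ≈ f k
  sumTo-single zero    zero f _   _   = refl
  sumTo-single (suc n) k    f k≤n f≈0 with k ℕ.≟ suc n
  ... | yes ≡.refl = begin
    sumTo n f + f (suc n)      ≈⟨ +-congʳ (sumTo-zero n f (λ i i≤n → f≈0 i (ℕ.m≤n⇒m≤1+n i≤n) (ℕ.<⇒≢ (s≤s i≤n)))) ⟩
    0# + f (suc n)             ≈⟨ +-identityˡ _ ⟩
    f (suc n)                  ∎
  ... | no k≢1+n = begin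
    sumTo n f + f (suc n)      ≈⟨ +-cong (sumTo-single n k f (ℕ.≤-pred (ℕ.≤∧≢⇒< k≤n k≢1+n)) (λ i i≤n → f≈0 i (ℕ.m≤n⇒m≤1+n i≤n)))
                                         (f≈0 (suc n) ℕ.≤-refl (k≢1+n ∘ ≡.sym)) ⟩
    f k + 0#                   ≈⟨ +-identityʳ _ ⟩
    f k                        ∎

  δ : ℕ → ℕ → Carrier
  δ zero    zero    = 1#
  δ zero    (suc j) = 0#
  δ (suc n) zero    = 0#
  δ (suc n) (suc j) = δ n j

  δ-diagonal : ∀ n → δ n n ≈ 1#
  δ-diagonal zero    = refl
  δ-diagonal (suc n) = δ-diagonal n

  δ-off-diagonal : ∀ n j → j ≢ n → δ n j ≈ 0#
  δ-off-diagonal zero    zero    0≢0     = ⊥-elim (0≢0 ≡.refl)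
  δ-off-diagonal zero    (suc j) _       = refl
  δ-off-diagonal (suc n) zero    _       = refl
  δ-off-diagonal (suc n) (suc j) 1+j≢1+n = δ-off-diagonal n j (1+j≢1+n ∘ ≡.cong suc)

  sumTo-δ : ∀ n (f : ℕ → Carrier) → sumTo n (λ j → δ n j * f j) ≈ f n
  sumTo-δ n f = begin
    sumTo n (λ j → δ n j * f j)   ≈⟨ sumTo-single n n _ ℕ.≤-refl (λ j _ j≢n → trans (*-congʳ (δ-off-diagonal n j j≢n)) (zeroˡ _)) ⟩
    δ n n * f n                   ≈⟨ trans (*-congʳ (δ-diagonal n)) (*-identityˡ _) ⟩
    f n                           ∎

  Series : Set c
  Series = ℕ → Carrier

  infix  4 _≋_
  infixl 6 _⊕_
  infixr 7 _⊙_

  _≋_ : Series → Series → Set ℓ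
  f ≋ g = ∀ n → f n ≈ g n

  _⊕_ : Series → Series → Series
  (f ⊕ g) n = f n + g n

  _⊙_ : Carrier → Series → Series
  (a ⊙ f) n = a * f n

  linear : Carrier → Carrier → Series
  linear a b zero          = a
  linear a b (suc zero)    = b
  linear a b (suc (suc _)) = 0#

  𝟙 : Series
  𝟙 zero    = 1#
  𝟙 (suc _) = 0#

  ⋆-cong : ∀ {f f′ g g′} → f ≋ f′ → g ≋ g′ → f ⋆ g ≋ f′ ⋆ g′
  ⋆-cong f≋f′ g≋g′ n = sumTo-cong n (λ i → *-cong (f≋f′ i) (g≋g′ (n ∸ i)))

  ⋆-congˡ : ∀ f {g g′} → g ≋ g′ → f ⋆ g ≋ f ⋆ g′
  ⋆-congˡ f = ⋆-cong {f} (λ _ → refl)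

  ⋆-congʳ : ∀ {f f′} g → f ≋ f′ → f ⋆ g ≋ f′ ⋆ g
  ⋆-congʳ g f≋f′ = ⋆-cong {g = g} f≋f′ (λ _ → refl)

  ⋆-comm : ∀ f g → f ⋆ g ≋ g ⋆ f
  ⋆-comm f g n = begin
    sumTo n (λ i → f i * g (n ∸ i))               ≈⟨ sumTo-reverse n _ ⟩
    sumTo n (λ i → f (n ∸ i) * g (n ∸ (n ∸ i)))   ≈⟨ sumTo-cong-≤ n (λ i i≤n → trans (*-comm _ _)
                                                       (*-congʳ (reflexive (≡.cong g (ℕ.m∸[m∸n]≡n i≤n))))) ⟩
    sumTo n (λ i → g i * f (n ∸ i))               ∎

  ⋆-assoc : ∀ f g h → (f ⋆ g) ⋆ h ≋ f ⋆ (g ⋆ h)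
  ⋆-assoc f g h n = begin
    sumTo n (λ k → sumTo k (λ i → f i * g (k ∸ i)) * h (n ∸ k))
      ≈⟨ sumTo-cong n (λ k → trans (*-distribʳ-sumTo k _ _) (sumTo-cong-≤ k (λ i i≤k →
           *-congˡ (reflexive (≡.cong (λ j → h (n ∸ j)) (≡.sym (ℕ.m+[n∸m]≡n i≤k))))))) ⟩
    sumTo n (λ k → sumTo k (λ i → term i (k ∸ i))) ≈⟨ sumTo-triangle n term ⟩
    sumTo n (λ i → sumTo (n ∸ i) (term i))
      ≈⟨ sumTo-cong n (λ i → trans (sumTo-cong (n ∸ i) (λ j → trans (*-assoc _ _ _)
           (*-congˡ (*-congˡ (reflexive (≡.cong h (≡.sym (ℕ.∸-+-assoc n i j)))))))) (sym (*-distribˡ-sumTo (n ∸ i) _ _))) ⟩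
    sumTo n (λ i → f i * sumTo (n ∸ i) (λ j → g j * h (n ∸ i ∸ j))) ∎
    where
    term : ℕ → ℕ → Carrier
    term i j = f i * g j * h (n ∸ (i ℕ.+ j))

  ⋆-distribˡ-⊕ : ∀ f g h → f ⋆ (g ⊕ h) ≋ f ⋆ g ⊕ f ⋆ h
  ⋆-distribˡ-⊕ f g h n = trans (sumTo-cong n (λ i → distribˡ _ _ _)) (sumTo-distrib-+ n _ _)

  ⊙-⋆ : ∀ a f g → (a ⊙ f) ⋆ g ≋ a ⊙ (f ⋆ g)
  ⊙-⋆ a f g n = trans (sumTo-cong n (λ i → *-assoc _ _ _)) (sym (*-distribˡ-sumTo n _ _))

  ⋆-⊙ : ∀ a f g → f ⋆ (a ⊙ g) ≋ a ⊙ (f ⋆ g)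
  ⋆-⊙ a f g n = trans (⋆-comm f (a ⊙ g) n) (trans (⊙-⋆ a g f n) (*-congˡ (⋆-comm g f n)))

  linear-⋆-suc : ∀ a b f n → (linear a b ⋆ f) (suc n) ≈ a * f (suc n) + b * f n
  linear-⋆-suc a b f n = begin
    (linear a b ⋆ f) (suc n)                                      ≈⟨ sumTo-head n _ ⟩
    a * f (suc n) + sumTo n (λ i → linear a b (suc i) * f (n ∸ i)) ≈⟨ +-congˡ (sumTo-single n 0 _ z≤n higher≈0) ⟩
    a * f (suc n) + b * f n                                        ∎
    where
    higher≈0 : ∀ i → i ≤ n → i ≢ 0 → linear a b (suc i) * f (n ∸ i) ≈ 0#
    higher≈0 zero    _ 0≢0 = ⊥-elim (0≢0 ≡.refl)
    higher≈0 (suc i) _ _   = zeroˡ _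

  𝟙-⋆ : ∀ f → 𝟙 ⋆ f ≋ f
  𝟙-⋆ f zero    = *-identityˡ _
  𝟙-⋆ f (suc n) = trans (sumTo-head n _) (trans (+-cong (*-identityˡ _) (sumTo-zero n _ (λ _ _ → zeroˡ _))) (+-identityʳ _))

  ⋆-𝟙 : ∀ f → f ⋆ 𝟙 ≋ f
  ⋆-𝟙 f n = trans (⋆-comm f 𝟙 n) (𝟙-⋆ f n)

  spow-zero : ∀ f → spow f 0 ≋ 𝟙
  spow-zero f zero    = refl
  spow-zero f (suc n) = refl

  spow-one : ∀ f → spow f 1 ≋ f
  spow-one f n = trans (⋆-congˡ f (spow-zero f) n) (⋆-𝟙 f n)

  spow-+ : ∀ f i j → spow f (i ℕ.+ j) ≋ spow f i ⋆ spow f j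
  spow-+ f zero    j n = sym (trans (⋆-congʳ (spow f j) (spow-zero f) n) (𝟙-⋆ (spow f j) n))
  spow-+ f (suc i) j n = trans (⋆-congˡ f (spow-+ f i j) n) (sym (⋆-assoc f (spow f i) (spow f j) n))

  spow-sucʳ : ∀ f k → spow f (suc k) ≋ spow f k ⋆ f
  spow-sucʳ f k = ⋆-comm f (spow f k)

  spow-vanish : ∀ f → f 0 ≈ 0# → ∀ k n → n < k → spow f k n ≈ 0#
  spow-vanish f f₀≈0 (suc k) n n<1+k = sumTo-zero n _ term≈0
    where
    term≈0 : ∀ i → i ≤ n → f i * spow f k (n ∸ i) ≈ 0#
    term≈0 zero    _   = trans (*-congʳ f₀≈0) (zeroˡ _)
    term≈0 (suc i) i<n = trans (*-congˡ (spow-vanish f f₀≈0 k (n ∸ suc i) (n∸1+i<k i<n n<1+k))) (zeroʳ _)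
      where
      n∸1+i<k : ∀ {n i k} → i < n → n < suc k → n ∸ suc i < k
      n∸1+i<k {suc n} {i} _ n<1+k = ℕ.≤-<-trans (ℕ.m∸n≤m n i) (ℕ.≤-pred n<1+k)

  D : Series → Series
  D f n = ι (suc n) * f (suc n)

  θ : Series → Series
  θ f n = ι n * f n

  D-cong : ∀ {f g} → f ≋ g → D f ≋ D g
  D-cong f≋g n = *-congˡ (f≋g (suc n))

  θ-leibniz : ∀ f g → θ (f ⋆ g) ≋ θ f ⋆ g ⊕ f ⋆ θ g
  θ-leibniz f g n = begin
    ι n * sumTo n (λ i → f i * g (n ∸ i))             ≈⟨ *-distribˡ-sumTo n _ _ ⟩
    sumTo n (λ i → ι n * (f i * g (n ∸ i)))           ≈⟨ sumTo-cong-≤ n split ⟩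
    sumTo n (λ i → ι i * f i * g (n ∸ i) + f i * (ι (n ∸ i) * g (n ∸ i))) ≈⟨ sumTo-distrib-+ n _ _ ⟩
    (θ f ⋆ g) n + (f ⋆ θ g) n                          ∎
    where
    split : ∀ i → i ≤ n → ι n * (f i * g (n ∸ i)) ≈ ι i * f i * g (n ∸ i) + f i * (ι (n ∸ i) * g (n ∸ i))
    split i i≤n = begin
      ι n * (f i * g (n ∸ i))                         ≡⟨ ≡.cong (λ k → ι k * (f i * g (n ∸ i))) (ℕ.m+[n∸m]≡n i≤n) ⟨
      ι (i ℕ.+ (n ∸ i)) * (f i * g (n ∸ i))           ≈⟨ *-congʳ (ι-+ i (n ∸ i)) ⟩
      (ι i + ι (n ∸ i)) * (f i * g (n ∸ i))           ≈⟨ solve 4 (λ a b x y → (a :+ b) :* (x :* y) := a :* x :* y :+ x :* (b :* y))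
                                                           refl (ι i) (ι (n ∸ i)) (f i) (g (n ∸ i)) ⟩
      ι i * f i * g (n ∸ i) + f i * (ι (n ∸ i) * g (n ∸ i)) ∎

  D-leibniz : ∀ f g → D (f ⋆ g) ≋ D f ⋆ g ⊕ f ⋆ D g
  D-leibniz f g n = begin
    θ (f ⋆ g) (suc n)                                 ≈⟨ θ-leibniz f g (suc n) ⟩
    (θ f ⋆ g) (suc n) + (f ⋆ θ g) (suc n)             ≈⟨ +-cong (θ-shift f g) (trans (⋆-comm f (θ g) (suc n))
                                                           (trans (θ-shift g f) (⋆-comm (D g) f n))) ⟩
    (D f ⋆ g) n + (f ⋆ D g) n                         ∎
    where
    θ-shift : ∀ h k → (θ h ⋆ k) (suc n) ≈ (D h ⋆ k) n
    θ-shift h k = trans (sumTo-head n _) (trans (+-congʳ (trans (*-congʳ (zeroˡ _)) (zeroˡ _))) (+-identityˡ _))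

  D-spow : ∀ f k → D (spow f (suc k)) ≋ ι (suc k) ⊙ (spow f k ⋆ D f)
  D-spow f zero n = begin
    D (spow f 1) n                                    ≈⟨ D-cong (spow-one f) n ⟩
    D f n                                             ≈⟨ sym (trans (*-congʳ (+-identityʳ 1#)) (*-identityˡ _)) ⟩
    ι 1 * D f n                                       ≈⟨ *-congˡ (sym (trans (⋆-congʳ (D f) (spow-zero f) n) (𝟙-⋆ (D f) n))) ⟩
    ι 1 * (spow f 0 ⋆ D f) n                          ∎
  D-spow f (suc k) n = begin
    D (f ⋆ fᵏ⁺¹) n                                    ≈⟨ D-leibniz f fᵏ⁺¹ n ⟩
    (D f ⋆ fᵏ⁺¹) n + (f ⋆ D fᵏ⁺¹) n                   ≈⟨ +-cong (⋆-comm (D f) fᵏ⁺¹ n)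
                                                           (trans (⋆-congˡ f (D-spow f k) n) (⋆-⊙ (ι (suc k)) f (spow f k ⋆ D f) n)) ⟩
    (fᵏ⁺¹ ⋆ D f) n + ι (suc k) * (f ⋆ (spow f k ⋆ D f)) n
                                                      ≈⟨ +-congˡ (*-congˡ (sym (⋆-assoc f (spow f k) (D f) n))) ⟩
    (fᵏ⁺¹ ⋆ D f) n + ι (suc k) * (fᵏ⁺¹ ⋆ D f) n       ≈⟨ solve 2 (λ x a → x :+ a :* x := (con 1ℤ :+ a) :* x) refl _ (ι (suc k)) ⟩
    ι (suc (suc k)) * (fᵏ⁺¹ ⋆ D f) n                  ∎
    where fᵏ⁺¹ = spow f (suc k)

  linear-⋆-D : ∀ a b g n → (linear a b ⋆ D g) n ≈ a * (ι (suc n) * g (suc n)) + b * (ι n * g n)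
  linear-⋆-D a b g zero    = sym (trans (+-congˡ (trans (*-congˡ (zeroˡ _)) (zeroʳ _))) (+-identityʳ _))
  linear-⋆-D a b g (suc n) = linear-⋆-suc a b (D g) n

  D^ : ℕ → Series → Series
  D^ zero    f = f
  D^ (suc k) f = D (D^ k f)

  D^-coefficient : ∀ k f m → ι (fact m) * D^ k f m ≈ ι (fact (m ℕ.+ k)) * f (m ℕ.+ k)
  D^-coefficient zero    f m = reflexive (≡.cong (λ j → ι (fact j) * f j) (≡.sym (ℕ.+-identityʳ m)))
  D^-coefficient (suc k) f m = begin
    ι (fact m) * (ι (suc m) * D^ k f (suc m))     ≈⟨ sym (*-assoc _ _ _) ⟩
    ι (fact m) * ι (suc m) * D^ k f (suc m)       ≈⟨ *-congʳ (trans (*-comm _ _) (sym (ι-* (suc m) (fact m)))) ⟩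
    ι (fact (suc m)) * D^ k f (suc m)             ≈⟨ D^-coefficient k f (suc m) ⟩
    ι (fact (suc m ℕ.+ k)) * f (suc m ℕ.+ k)      ≡⟨ ≡.cong (λ j → ι (fact j) * f j) (ℕ.+-suc m k) ⟨
    ι (fact (m ℕ.+ suc k)) * f (m ℕ.+ suc k)      ∎

  infixr 9 _∘ˢ_
  _∘ˢ_ : Series → Series → Series
  (A ∘ˢ g) n = sumTo n (λ k → A k * spow g k n)

  ∘ˢ-cong : ∀ {A B} g → A ≋ B → A ∘ˢ g ≋ B ∘ˢ g
  ∘ˢ-cong g A≋B n = sumTo-cong n (λ k → *-congʳ (A≋B k))

  module _ {g : Series} (g₀≈0 : g 0 ≈ 0#) where

    ∘ˢ-extend : ∀ A {n N} → n ≤ N → sumTo N (λ k → A k * spow g k n) ≈ (A ∘ˢ g) n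
    ∘ˢ-extend A n≤N = sumTo-extend _ n≤N (λ k n<k → trans (*-congˡ (spow-vanish g g₀≈0 k _ n<k)) (zeroʳ _))

    private
      double-sum : Series → Series → ℕ → Carrier
      double-sum A B n = sumTo n (λ i → sumTo n (λ j → A i * B j * spow g (i ℕ.+ j) n))

      ⋆-∘ˢ≈double-sum : ∀ A B n → ((A ⋆ B) ∘ˢ g) n ≈ double-sum A B n
      ⋆-∘ˢ≈double-sum A B n = begin
        sumTo n (λ k → sumTo k (λ i → A i * B (k ∸ i)) * spow g k n)
          ≈⟨ sumTo-cong n (λ k → trans (*-distribʳ-sumTo k _ _) (sumTo-cong-≤ k (λ i i≤k →
               *-congˡ (reflexive (≡.cong (λ j → spow g j n) (≡.sym (ℕ.m+[n∸m]≡n i≤k))))))) ⟩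
        sumTo n (λ k → sumTo k (λ i → term i (k ∸ i)))       ≈⟨ sumTo-triangle n term ⟩
        sumTo n (λ i → sumTo (n ∸ i) (term i))
          ≈⟨ sumTo-cong-≤ n (λ i i≤n → sym (sumTo-extend (term i) (ℕ.m∸n≤m n i) (λ j n∸i<j →
               trans (*-congˡ (spow-vanish g g₀≈0 (i ℕ.+ j) n (n<i+j i≤n n∸i<j))) (zeroʳ _)))) ⟩
        double-sum A B n                                     ∎
        where
        term : ℕ → ℕ → Carrier
        term i j = A i * B j * spow g (i ℕ.+ j) n
        n<i+j : ∀ {i j} → i ≤ n → n ∸ i < j → n < i ℕ.+ j
        n<i+j {i} i≤n n∸i<j = ≡.subst (_< i ℕ.+ _) (ℕ.m+[n∸m]≡n i≤n) (ℕ.+-monoʳ-< i n∸i<j)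

      ∘ˢ-⋆-∘ˢ≈double-sum : ∀ A B n → ((A ∘ˢ g) ⋆ (B ∘ˢ g)) n ≈ double-sum A B n
      ∘ˢ-⋆-∘ˢ≈double-sum A B n = begin
        sumTo n (λ p → (A ∘ˢ g) p * (B ∘ˢ g) (n ∸ p))
          ≈⟨ sumTo-cong-≤ n (λ p p≤n → sym (*-cong (∘ˢ-extend A p≤n) (∘ˢ-extend B (ℕ.m∸n≤m n p)))) ⟩
        sumTo n (λ p → sumTo n (λ i → A i * spow g i p) * sumTo n (λ j → B j * spow g j (n ∸ p)))
          ≈⟨ sumTo-cong n (λ p → sumTo-*-sumTo n n _ _) ⟩
        sumTo n (λ p → sumTo n (λ i → sumTo n (λ j → A i * spow g i p * (B j * spow g j (n ∸ p)))))
          ≈⟨ trans (sumTo-comm n n _) (sumTo-cong n (λ i → sumTo-comm n n _)) ⟩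
        sumTo n (λ i → sumTo n (λ j → sumTo n (λ p → A i * spow g i p * (B j * spow g j (n ∸ p)))))
          ≈⟨ sumTo-cong n (λ i → sumTo-cong n (λ j → begin
               sumTo n (λ p → A i * spow g i p * (B j * spow g j (n ∸ p)))
                 ≈⟨ sumTo-cong n (λ p → solve 4 (λ a x b y → a :* x :* (b :* y) := a :* b :* (x :* y)) refl _ _ _ _) ⟩
               sumTo n (λ p → A i * B j * (spow g i p * spow g j (n ∸ p)))
                 ≈⟨ sym (*-distribˡ-sumTo n _ _) ⟩
               A i * B j * (spow g i ⋆ spow g j) n
                 ≈⟨ *-congˡ (sym (spow-+ g i j n)) ⟩
               A i * B j * spow g (i ℕ.+ j) n ∎)) ⟩
        double-sum A B n ∎

    ∘ˢ-⋆ : ∀ A B → (A ⋆ B) ∘ˢ g ≋ (A ∘ˢ g) ⋆ (B ∘ˢ g)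
    ∘ˢ-⋆ A B n = trans (⋆-∘ˢ≈double-sum A B n) (sym (∘ˢ-⋆-∘ˢ≈double-sum A B n))

    t-∘ˢ : linear 0# 1# ∘ˢ g ≋ g
    t-∘ˢ zero    = trans (zeroˡ _) (sym g₀≈0)
    t-∘ˢ (suc n) = begin
      (linear 0# 1# ∘ˢ g) (suc n)                 ≈⟨ sumTo-single (suc n) 1 _ (s≤s z≤n) t≈0 ⟩
      1# * spow g 1 (suc n)                       ≈⟨ trans (*-identityˡ _) (spow-one g (suc n)) ⟩
      g (suc n)                                   ∎
      where
      t≈0 : ∀ i → i ≤ suc n → i ≢ 1 → linear 0# 1# i * spow g i (suc n) ≈ 0#
      t≈0 zero          _ _   = zeroˡ _
      t≈0 (suc zero)    _ 1≢1 = ⊥-elim (1≢1 ≡.refl)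
      t≈0 (suc (suc i)) _ _   = zeroˡ _

  t-⋆ : ∀ f n → (linear 0# 1# ⋆ f) (suc n) ≈ f n
  t-⋆ f n = trans (linear-⋆-suc 0# 1# f n) (trans (+-cong (zeroˡ _) (*-identityˡ _)) (+-identityˡ _))

  dfall-cong : ∀ {x y} h k → x ≈ y → dfall x h k ≈ dfall y h k
  dfall-cong h zero    x≈y = refl
  dfall-cong h (suc k) x≈y = *-cong (dfall-cong h k x≈y) (+-congʳ x≈y)

  dfall-shift : ∀ x h m → dfall (x + h) h (suc m) ≈ (x + h) * dfall x h m
  dfall-shift x h zero = solve 2 (λ x h → con 1ℤ :* ((x :+ h) :- con 0ℤ :* h) := (x :+ h) :* con 1ℤ) refl x h
  dfall-shift x h (suc m) = begin
    dfall (x + h) h (suc m) * (x + h - ι (suc m) * h)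
      ≈⟨ *-cong (dfall-shift x h m) (solve 3 (λ x h a → x :+ h :- (con 1ℤ :+ a) :* h := x :- a :* h) refl x h (ι m)) ⟩
    (x + h) * dfall x h m * (x - ι m * h)               ≈⟨ *-assoc _ _ _ ⟩
    (x + h) * dfall x h (suc m)                         ∎

  dfall-root : ∀ h {k j} → k ≤ j → dfall (ι k * h) h (suc j) ≈ 0#
  dfall-root h {k} {j} k≤j with ℕ.m≤n⇒m<n∨m≡n k≤j
  ... | inj₂ ≡.refl = trans (*-congˡ (-‿inverseʳ _)) (zeroʳ _)
  dfall-root h {k} {suc j} k≤j | inj₁ k<1+j = trans (*-congʳ (dfall-root h (ℕ.≤-pred k<1+j))) (zeroˡ _)

  dfall-≉0 : ∀ {h} → ¬ (h ≈ 0#) → ∀ {k} j → j ≤ k → ¬ (dfall (ι k * h) h j ≈ 0#)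
  dfall-≉0 h≉0 zero    _     = 1#≉0#
  dfall-≉0 {h} h≉0 {k} (suc j) 1+j≤k = *-≉0 (dfall-≉0 h≉0 j (ℕ.<⇒≤ 1+j≤k)) factor≉0
    where
    factor≉0 : ¬ (ι k * h - ι j * h ≈ 0#)
    factor≉0 factor≈0 = *-≉0 (charZero (k ∸ suc j)) h≉0 (begin
      ι (suc (k ∸ suc j)) * h  ≡⟨ ≡.cong (λ m → ι m * h) (ℕ.+-∸-assoc 1 1+j≤k) ⟨
      ι (k ∸ j) * h            ≈⟨ *-congʳ (ι-∸ (ℕ.<⇒≤ 1+j≤k)) ⟩
      (ι k - ι j) * h          ≈⟨ solve 3 (λ a b x → (a :- b) :* x := a :* x :- b :* x) refl (ι k) (ι j) h ⟩
      ι k * h - ι j * h        ≈⟨ factor≈0 ⟩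
      0#                       ∎)

  dfall-independent : ∀ {h} → ¬ (h ≈ 0#) → ∀ n (a : ℕ → Carrier) →
    (∀ x → sumTo n (λ k → a k * dfall x h k) ≈ 0#) → ∀ k → k ≤ n → a k ≈ 0#
  dfall-independent {h} h≉0 n a combination≈0 = <-rec (λ k → k ≤ n → a k ≈ 0#) step
    where
    step : ∀ k → (∀ {i} → i < k → i ≤ n → a i ≈ 0#) → k ≤ n → a k ≈ 0#
    step k earlier≈0 k≤n = *-cancelʳ-≉0 (dfall-≉0 h≉0 k ℕ.≤-refl) (begin
      a k * dfall (ι k * h) h k                        ≈⟨ sumTo-single n k _ k≤n other≈0 ⟨
      sumTo n (λ i → a i * dfall (ι k * h) h i)        ≈⟨ combination≈0 (ι k * h) ⟩
      0#                                               ∎)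
      where
      other≈0 : ∀ i → i ≤ n → i ≢ k → a i * dfall (ι k * h) h i ≈ 0#
      other≈0 i i≤n i≢k with ℕ.<-cmp i k
      ... | tri< i<k _ _ = trans (*-congʳ (earlier≈0 i<k i≤n)) (zeroˡ _)
      ... | tri≈ _ i≡k _ = ⊥-elim (i≢k i≡k)
      other≈0 (suc i) i≤n i≢k | tri> _ _ k<1+i = trans (*-congˡ (dfall-root h (ℕ.≤-pred k<1+i))) (zeroʳ _)

  dfall-unique : ∀ {h} → ¬ (h ≈ 0#) → ∀ n (a b : ℕ → Carrier) →
    (∀ x → sumTo n (λ k → a k * dfall x h k) ≈ sumTo n (λ k → b k * dfall x h k)) → ∀ k → k ≤ n → a k ≈ b k
  dfall-unique {h} h≉0 n a b same k k≤n =
    x∙y⁻¹≈ε⇒x≈y (a k) (b k) (dfall-independent h≉0 n (λ k → a k - b k) difference≈0 k k≤n)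
    where
    difference≈0 : ∀ x → sumTo n (λ k → (a k - b k) * dfall x h k) ≈ 0#
    difference≈0 x = begin
      sumTo n (λ k → (a k - b k) * dfall x h k)
        ≈⟨ sumTo-cong n (λ k → solve 3 (λ p q d → (p :- q) :* d := p :* d :+ :- (q :* d)) refl (a k) (b k) (dfall x h k)) ⟩
      sumTo n (λ k → a k * dfall x h k + - (b k * dfall x h k))   ≈⟨ sumTo-distrib-+ n _ _ ⟩
      sumTo n (λ k → a k * dfall x h k) + sumTo n (λ k → - (b k * dfall x h k))
        ≈⟨ +-cong (same x) (sym (-‿distrib-sumTo n _)) ⟩
      sumTo n (λ k → b k * dfall x h k) - sumTo n (λ k → b k * dfall x h k) ≈⟨ -‿inverseʳ _ ⟩
      0#                                                          ∎

  linearCombination : ℕ → (ℕ → Carrier) → (ℕ → Series) → Series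
  linearCombination N a w m = sumTo N (λ k → a k * w k m)

  shiftʳ : (ℕ → ℕ → Carrier) → ℕ → ℕ → Carrier
  shiftʳ A n zero    = 0#
  shiftʳ A n (suc k) = A n k

  -- Such an A is the connection triangle (x)_{n,h′} = Σₖ A(n,k) (x)_{k,h} (`dfall-expansion`); the
  -- inductive argument is isolated in `expand` because it also expands the B-algorithm matrix.
  module Connection (h h′ : Carrier) (A : ℕ → ℕ → Carrier)
    (A-rec : ∀ n k → A (suc n) k ≈ shiftʳ A n k + (ι k * h - ι n * h′) * A n k)
    (A-corner : A 0 0 ≈ 1#) (A-top : ∀ k → A 0 (suc k) ≈ 0#) where

    A-vanish : ∀ {n k} → n < k → A n k ≈ 0#
    A-vanish {zero}  {suc k} _ = A-top k
    A-vanish {suc n} {suc k} (s≤s n<k) = begin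
      A (suc n) (suc k)                                   ≈⟨ A-rec n (suc k) ⟩
      A n k + (ι (suc k) * h - ι n * h′) * A n (suc k)    ≈⟨ +-cong (A-vanish n<k) (*-congˡ (A-vanish (ℕ.m≤n⇒m≤1+n n<k))) ⟩
      0# + (ι (suc k) * h - ι n * h′) * 0#                ≈⟨ trans (+-identityˡ _) (zeroʳ _) ⟩
      0#                                                  ∎

    expand : (V W : ℕ → Series) (T : ℕ → Series → Series) →
      (∀ n {f g} → f ≋ g → T n f ≋ T n g) →
      (∀ n N a w → T n (linearCombination N a w) ≋ linearCombination N a (λ k → T n (w k))) →
      (∀ n k → T n (W k) ≋ W (suc k) ⊕ (ι k * h - ι n * h′) ⊙ W k) →
      V 0 ≋ W 0 → (∀ n → V (suc n) ≋ T n (V n)) →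
      ∀ n → V n ≋ linearCombination n (A n) W
    expand V W T T-cong T-linear T-W V₀ V-rec zero m =
      trans (V₀ m) (trans (sym (*-identityˡ _)) (*-congʳ (sym A-corner)))
    expand V W T T-cong T-linear T-W V₀ V-rec (suc n) m = begin
      V (suc n) m                                                ≈⟨ V-rec n m ⟩
      T n (V n) m                                                ≈⟨ T-cong n (expand V W T T-cong T-linear T-W V₀ V-rec n) m ⟩
      T n (linearCombination n (A n) W) m                        ≈⟨ T-linear n n (A n) W m ⟩
      sumTo n (λ k → A n k * T n (W k) m)                        ≈⟨ sumTo-cong n (λ k → trans (*-congˡ (T-W n k m)) (distribˡ _ _ _)) ⟩
      sumTo n (λ k → A n k * W (suc k) m + A n k * (step k * W k m)) ≈⟨ sumTo-distrib-+ n _ _ ⟩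
      sumTo n (λ k → A n k * W (suc k) m) + sumTo n (λ k → A n k * (step k * W k m))
                                                                 ≈⟨ +-cong shifted diagonal ⟩
      sumTo (suc n) (λ k → shiftʳ A n k * W k m) + sumTo (suc n) (λ k → step k * A n k * W k m)
                                                                 ≈⟨ sym (sumTo-distrib-+ (suc n) _ _) ⟩
      sumTo (suc n) (λ k → shiftʳ A n k * W k m + step k * A n k * W k m)
        ≈⟨ sumTo-cong (suc n) (λ k → trans (sym (distribʳ _ _ _)) (*-congʳ (sym (A-rec n k)))) ⟩
      sumTo (suc n) (λ k → A (suc n) k * W k m)                  ∎
      where
      step : ℕ → Carrier
      step k = ι k * h - ι n * h′

      shifted : sumTo n (λ k → A n k * W (suc k) m) ≈ sumTo (suc n) (λ k → shiftʳ A n k * W k m)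
      shifted = sym (trans (sumTo-head n _) (trans (+-congʳ (zeroˡ _)) (+-identityˡ _)))

      diagonal : sumTo n (λ k → A n k * (step k * W k m)) ≈ sumTo (suc n) (λ k → step k * A n k * W k m)
      diagonal = sym (begin
        sumTo n (λ k → step k * A n k * W k m) + step (suc n) * A n (suc n) * W (suc n) m
          ≈⟨ +-congˡ (trans (*-congʳ (trans (*-congˡ (A-vanish (ℕ.n<1+n n))) (zeroʳ _))) (zeroˡ _)) ⟩
        sumTo n (λ k → step k * A n k * W k m) + 0#
          ≈⟨ trans (+-identityʳ _) (sumTo-cong n (λ k → solve 3 (λ p q r → p :* q :* r := q :* (p :* r)) refl _ _ _)) ⟩
        sumTo n (λ k → A n k * (step k * W k m)) ∎)

    dfall-expansion : ∀ x n → dfall x h′ n ≈ sumTo n (λ k → A n k * dfall x h k)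
    dfall-expansion x n = expand (λ n _ → dfall x h′ n) (λ k _ → dfall x h k) (λ n f m → f m * (x - ι n * h′))
      (λ n f≋g m → *-congʳ (f≋g m))
      (λ n N a w m → trans (*-distribʳ-sumTo N _ _) (sumTo-cong N (λ k → *-assoc _ _ _)))
      (λ n k m → solve 4 (λ d y b e → d :* (y :- b) := d :* (y :- e) :+ (e :- b) :* d) refl (dfall x h k) x (ι n * h′) (ι k * h))
      (λ _ → refl) (λ _ _ → refl) n 0

  module Degenerate (l : Carrier) where

    stirling2 : ℕ → ℕ → Carrier
    stirling2 zero    zero    = 1#
    stirling2 zero    (suc k) = 0#
    stirling2 (suc n) zero    = 0# + (ι 0 * 1# - ι n * l) * stirling2 n 0
    stirling2 (suc n) (suc k) = stirling2 n k + (ι (suc k) * 1# - ι n * l) * stirling2 n (suc k)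

    stirling2-rec : ∀ n k → stirling2 (suc n) k ≈ shiftʳ stirling2 n k + (ι k * 1# - ι n * l) * stirling2 n k
    stirling2-rec n zero    = refl
    stirling2-rec n (suc k) = refl

    module Stirling2 = Connection 1# l stirling2 stirling2-rec refl (λ _ → refl)

    Q : Series
    Q = linear (- 1#) 1#

    D-Q : D Q ≋ 𝟙
    D-Q zero    = trans (*-congʳ (+-identityʳ 1#)) (*-identityˡ 1#)
    D-Q (suc n) = zeroʳ _

    Q⋆D-Qᵏ : ∀ k → Q ⋆ D (spow Q k) ≋ ι k ⊙ spow Q k
    Q⋆D-Qᵏ zero n = trans (sumTo-zero n _ (λ _ _ → trans (*-congˡ (zeroʳ _)) (zeroʳ _))) (sym (zeroˡ _))
    Q⋆D-Qᵏ (suc k) n = begin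
      (Q ⋆ D (spow Q (suc k))) n                  ≈⟨ trans (⋆-congˡ Q (D-spow Q k) n) (⋆-⊙ (ι (suc k)) Q (spow Q k ⋆ D Q) n) ⟩
      ι (suc k) * (Q ⋆ (spow Q k ⋆ D Q)) n        ≈⟨ *-congˡ (⋆-congˡ Q (λ m → trans (⋆-congˡ (spow Q k) D-Q m) (⋆-𝟙 (spow Q k) m)) n) ⟩
      ι (suc k) * spow Q (suc k) n                ∎

    E : ℕ → Series
    E k = spow Q k ⋆ D^ k (amat l 0)

    Q⋆D-E : ∀ k → Q ⋆ D (E k) ≋ ι k ⊙ E k ⊕ E (suc k)
    Q⋆D-E k n = begin
      (Q ⋆ D (Qᵏ ⋆ G)) n                          ≈⟨ trans (⋆-congˡ Q (D-leibniz Qᵏ G) n) (⋆-distribˡ-⊕ Q (D Qᵏ ⋆ G) (Qᵏ ⋆ D G) n) ⟩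
      (Q ⋆ (D Qᵏ ⋆ G)) n + (Q ⋆ (Qᵏ ⋆ D G)) n     ≈⟨ +-cong (sym (⋆-assoc Q (D Qᵏ) G n)) (sym (⋆-assoc Q Qᵏ (D G) n)) ⟩
      ((Q ⋆ D Qᵏ) ⋆ G) n + ((Q ⋆ Qᵏ) ⋆ D G) n     ≈⟨ +-congʳ (trans (⋆-congʳ G (Q⋆D-Qᵏ k) n) (⊙-⋆ (ι k) Qᵏ G n)) ⟩
      ι k * E k n + E (suc k) n                   ∎
      where
      Qᵏ = spow Q k
      G = D^ k (amat l 0)

    T : ℕ → Series → Series
    T n f m = (ι m - ι n * l) * f m - ι (suc m) * f (suc m)

    T-cong : ∀ n {f g} → f ≋ g → T n f ≋ T n g
    T-cong n f≋g m = +-cong (*-congˡ (f≋g m)) (-‿cong (*-congˡ (f≋g (suc m))))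

    T-linear : ∀ n N a w → T n (linearCombination N a w) ≋ linearCombination N a (λ k → T n (w k))
    T-linear n N a w m = begin
      α * sumTo N (λ k → a k * w k m) - ι (suc m) * sumTo N (λ k → a k * w k (suc m))
        ≈⟨ +-cong (*-distribˡ-sumTo N _ _) (trans (-‿cong (*-distribˡ-sumTo N _ _)) (-‿distrib-sumTo N _)) ⟩
      sumTo N (λ k → α * (a k * w k m)) + sumTo N (λ k → - (ι (suc m) * (a k * w k (suc m))))
        ≈⟨ sym (sumTo-distrib-+ N _ _) ⟩
      sumTo N (λ k → α * (a k * w k m) + - (ι (suc m) * (a k * w k (suc m))))
        ≈⟨ sumTo-cong N (λ k → solve 5 (λ α a x y s → α :* (a :* x) :+ :- (s :* (a :* y)) := a :* (α :* x :- s :* y))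
                                   refl α (a k) (w k m) (w k (suc m)) (ι (suc m))) ⟩
      sumTo N (λ k → a k * T n (w k) m) ∎
      where α = ι m - ι n * l

    T-E : ∀ n k → T n (E k) ≋ E (suc k) ⊕ (ι k * 1# - ι n * l) ⊙ E k
    T-E n k m = begin
      T n (E k) m
        ≈⟨ solve 6 (λ a b λ′ s e₀ e₁ → (a :- b :* λ′) :* e₀ :- s :* e₁
                                      := ((:- con 1ℤ) :* (s :* e₁) :+ con 1ℤ :* (a :* e₀)) :- b :* λ′ :* e₀)
             refl (ι m) (ι n) l (ι (suc m)) (E k m) (E k (suc m)) ⟩
      (- 1# * (ι (suc m) * E k (suc m)) + 1# * (ι m * E k m)) - ι n * l * E k m
        ≈⟨ +-congʳ (trans (sym (linear-⋆-D (- 1#) 1# (E k) m)) (Q⋆D-E k m)) ⟩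
      (ι k * E k m + E (suc k) m) - ι n * l * E k m
        ≈⟨ solve 5 (λ a b λ′ e e′ → (a :* e :+ e′) :- b :* λ′ :* e := e′ :+ (a :* con 1ℤ :- b :* λ′) :* e)
             refl (ι k) (ι n) l (E k m) (E (suc k) m) ⟩
      E (suc k) m + (ι k * 1# - ι n * l) * E k m   ∎

    amat-expansion : ∀ n → amat l n ≋ linearCombination n (stirling2 n) E
    amat-expansion = Stirling2.expand (amat l) E T T-cong T-linear T-E
      (λ m → sym (trans (⋆-congʳ (amat l 0) (spow-zero Q) m) (𝟙-⋆ (amat l 0) m))) (λ _ _ → refl)

    Qᵏ₀ : ∀ k → spow Q k 0 ≈ sgn k
    Qᵏ₀ zero    = refl
    Qᵏ₀ (suc k) = trans (sym (-‿distribˡ-* _ _)) (-‿cong (trans (*-identityˡ _) (Qᵏ₀ k)))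

    E₀ : ∀ k → E k 0 ≈ sgn k * (ι (fact k) * amat l 0 k)
    E₀ k = *-cong (Qᵏ₀ k) (trans (sym (trans (*-congʳ (+-identityʳ 1#)) (*-identityˡ _))) (D^-coefficient k (amat l 0) 0))

    module _ (S2 : ℕ → ℕ → Carrier) (isS2 : IsDegStirling2 l S2) where

      S2≈stirling2 : ∀ n k → k ≤ n → S2 n k ≈ stirling2 n k
      S2≈stirling2 n = dfall-unique 1#≉0# n (S2 n) (stirling2 n) (λ x → trans (sym (isS2 n x)) (Stirling2.dfall-expansion x n))

      amat-first-column : ∀ n → amat l n 0 ≈ sumTo n (λ k → (sgn k * ι (fact k) * S2 n k * binomλ l k) /suc k)
      amat-first-column n = begin
        amat l n 0                                     ≈⟨ amat-expansion n 0 ⟩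
        sumTo n (λ k → stirling2 n k * E k 0)          ≈⟨ sumTo-cong-≤ n (λ k k≤n → *-cong (sym (S2≈stirling2 n k k≤n)) (E₀ k)) ⟩
        sumTo n (λ k → S2 n k * (sgn k * (ι (fact k) * (binomλ l k /suc k))))
          ≈⟨ sumTo-cong n (λ k → solve 5 (λ s₂ s f b i → s₂ :* (s :* (f :* (b :* i))) := (s :* f :* s₂ :* b) :* i)
                                     refl (S2 n k) (sgn k) (ι (fact k)) (binomλ l k) (inv _ (charZero k))) ⟩
        sumTo n (λ k → (sgn k * ι (fact k) * S2 n k * binomλ l k) /suc k) ∎

    L : Series
    L = logλ l

    D-L : ∀ n → D L n ≈ sgn n * binomλ l n
    D-L n = trans (*-comm _ _) (/suc-inverseʳ _ n)

    [1+t]⋆D-L : linear 1# 1# ⋆ D L ≋ 𝟙 ⊕ l ⊙ L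
    [1+t]⋆D-L zero = begin
      1# * D L 0                  ≈⟨ trans (*-identityˡ _) (D-L 0) ⟩
      1# * (1# /suc 0)            ≈⟨ trans (*-identityˡ _) (/suc-zero 1#) ⟩
      1#                          ≈⟨ sym (trans (+-congˡ (zeroʳ l)) (+-identityʳ _)) ⟩
      1# + l * 0#                 ∎
    [1+t]⋆D-L (suc m) = begin
      (linear 1# 1# ⋆ D L) (suc m)     ≈⟨ linear-⋆-suc 1# 1# (D L) m ⟩
      1# * D L (suc m) + 1# * D L m   ≈⟨ +-cong (trans (*-identityˡ _) (D-L (suc m))) (trans (*-identityˡ _) (D-L m)) ⟩
      cₘ₊₁ + cₘ                        ≈⟨ /suc-unique m key ⟩
      (l * cₘ) /suc m                  ≈⟨ sym (trans (+-identityˡ _) (sym (*-assoc _ _ _))) ⟩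
      0# + l * L (suc m)               ∎
      where
      y = ι m - l
      cₘ = sgn m * binomλ l m
      cₘ₊₁ = sgn (suc m) * binomλ l (suc m)
      binom-step : binomλ l (suc m) * ι (suc m) ≈ (y + 1#) * binomλ l m
      binom-step = begin
        binomλ l (suc m) * ι (suc m)              ≈⟨ /fact-suc _ m ⟩
        fall (ι (suc m) - l) (suc m) /fact m      ≈⟨ *-congʳ (dfall-cong 1# (suc m)
                                                       (solve 2 (λ a b → (con 1ℤ :+ a) :- b := (a :- b) :+ con 1ℤ) refl (ι m) l)) ⟩
        fall (y + 1#) (suc m) /fact m             ≈⟨ *-congʳ (dfall-shift y 1# m) ⟩
        ((y + 1#) * fall y m) /fact m             ≈⟨ *-assoc _ _ _ ⟩
        (y + 1#) * binomλ l m                     ∎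
      key : (cₘ₊₁ + cₘ) * ι (suc m) ≈ l * cₘ
      key = begin
        (cₘ₊₁ + cₘ) * ι (suc m)                   ≈⟨ trans (distribʳ _ _ _) (+-congʳ (*-assoc _ _ _)) ⟩
        - sgn m * (binomλ l (suc m) * ι (suc m)) + cₘ * ι (suc m)
                                                  ≈⟨ +-congʳ (*-congˡ binom-step) ⟩
        - sgn m * ((y + 1#) * binomλ l m) + sgn m * binomλ l m * (1# + ι m)
          ≈⟨ solve 4 (λ s b a λ′ → :- s :* ((a :- λ′ :+ con 1ℤ) :* b) :+ s :* b :* (con 1ℤ :+ a) := λ′ :* (s :* b))
               refl (sgn m) (binomλ l m) (ι m) l ⟩
        l * cₘ                                    ∎

    [1+t]⋆D-Lᵏ⁺¹ : ∀ k n → ι (suc n) * spow L (suc k) (suc n) + ι n * spow L (suc k) n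
                         ≈ ι (suc k) * spow L k n + ι (suc k) * l * spow L (suc k) n
    [1+t]⋆D-Lᵏ⁺¹ k n = begin
      ι (suc n) * spow L (suc k) (suc n) + ι n * spow L (suc k) n
        ≈⟨ sym (trans (linear-⋆-D 1# 1# (spow L (suc k)) n) (+-cong (*-identityˡ _) (*-identityˡ _))) ⟩
      (1+t ⋆ D (spow L (suc k))) n              ≈⟨ trans (⋆-congˡ 1+t (D-spow L k) n) (⋆-⊙ (ι (suc k)) 1+t (Lᵏ ⋆ D L) n) ⟩
      ι (suc k) * (1+t ⋆ (Lᵏ ⋆ D L)) n          ≈⟨ *-congˡ (trans (sym (⋆-assoc 1+t Lᵏ (D L) n))
                                                     (trans (⋆-congʳ (D L) (⋆-comm 1+t Lᵏ) n) (⋆-assoc Lᵏ 1+t (D L) n))) ⟩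
      ι (suc k) * (Lᵏ ⋆ (1+t ⋆ D L)) n          ≈⟨ *-congˡ (trans (⋆-congˡ Lᵏ [1+t]⋆D-L n) (⋆-distribˡ-⊕ Lᵏ 𝟙 (l ⊙ L) n)) ⟩
      ι (suc k) * ((Lᵏ ⋆ 𝟙) n + (Lᵏ ⋆ (l ⊙ L)) n)
        ≈⟨ *-congˡ (+-cong (⋆-𝟙 Lᵏ n) (trans (⋆-⊙ l Lᵏ L n) (*-congˡ (sym (spow-sucʳ L k n))))) ⟩
      ι (suc k) * (Lᵏ n + l * spow L (suc k) n) ≈⟨ solve 4 (λ a z λ′ y → a :* (z :+ λ′ :* y) := a :* z :+ a :* λ′ :* y) refl _ _ _ _ ⟩
      ι (suc k) * Lᵏ n + ι (suc k) * l * spow L (suc k) n ∎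
      where
      1+t = linear 1# 1#
      Lᵏ = spow L k

    S1-rec : ∀ n k → S1 l (suc n) k ≈ shiftʳ (S1 l) n k + (ι k * l - ι n * 1#) * S1 l n k
    S1-rec n zero = begin
      ι (fact (suc n)) * (spow L 0 (suc n) /fact 0)   ≈⟨ trans (*-congˡ (zeroˡ _)) (zeroʳ _) ⟩
      0#                                              ≈⟨ trans (sym -0#≈0#) (-‿cong (sym (ι*S1₀≈0 n))) ⟩
      - (ι n * S1 l n 0)                              ≈⟨ solve 3 (λ λ′ a s → :- (a :* s) := con 0ℤ :+ (con 0ℤ :* λ′ :- a :* con 1ℤ) :* s)
                                                           refl l (ι n) (S1 l n 0) ⟩
      0# + (0# * l - ι n * 1#) * S1 l n 0            ∎
      where
      ι*S1₀≈0 : ∀ n → ι n * S1 l n 0 ≈ 0#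
      ι*S1₀≈0 zero    = zeroˡ _
      ι*S1₀≈0 (suc n) = trans (*-congˡ (trans (*-congˡ (zeroˡ _)) (zeroʳ _))) (zeroʳ _)
    S1-rec n (suc k) = begin
      ι (fact (suc n)) * (X * w)                      ≈⟨ *-congʳ (ι-* (suc n) (fact n)) ⟩
      ι (suc n) * f * (X * w)
        ≈⟨ solve 6 (λ a b f x y w → a :* f :* (x :* w) := f :* w :* ((a :* x :+ b :* y) :- b :* y))
                                                           refl (ι (suc n)) (ι n) f X Y w ⟩
      f * w * ((ι (suc n) * X + ι n * Y) - ι n * Y)   ≈⟨ *-congˡ (+-congʳ ([1+t]⋆D-Lᵏ⁺¹ k n)) ⟩
      f * w * ((ι (suc k) * Z + ι (suc k) * l * Y) - ι n * Y)
        ≈⟨ solve 7 (λ f w c z λ′ y b → f :* w :* ((c :* z :+ c :* λ′ :* y) :- b :* y)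
                                         := f :* (z :* w :* c) :+ (c :* λ′ :- b :* con 1ℤ) :* (f :* (y :* w)))
             refl f w (ι (suc k)) Z l Y (ι n) ⟩
      f * (Z * w * ι (suc k)) + (ι (suc k) * l - ι n * 1#) * (f * (Y * w))
                                                      ≈⟨ +-congʳ (*-congˡ (/fact-suc Z k)) ⟩
      f * (Z /fact k) + (ι (suc k) * l - ι n * 1#) * (f * (Y * w)) ∎
      where
      X = spow L (suc k) (suc n)
      Y = spow L (suc k) n
      Z = spow L k n
      f = ι (fact n)
      w = inv (ι (suc (fact (suc k) ∸ 1))) (charZero (fact (suc k) ∸ 1))

    S1-corner : S1 l 0 0 ≈ 1#
    S1-corner = trans (*-congˡ (*-identityˡ _)) (inverse _ (charZero 0))

    S1-top : ∀ k → S1 l 0 (suc k) ≈ 0#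
    S1-top k = trans (*-congˡ (trans (*-congʳ (zeroˡ _)) (zeroˡ _))) (zeroʳ _)

    module Stirling1 = Connection l 1# (S1 l) S1-rec S1-corner S1-top

    fact*[eλ-1∘L]≈fall1 : ∀ m → ι (fact (suc m)) * (eλm1 l ∘ˢ L) (suc m) ≈ fall 1# (suc m)
    fact*[eλ-1∘L]≈fall1 m = begin
      ι (fact n) * sumTo n (λ k → eλm1 l k * spow L k n)     ≈⟨ *-distribˡ-sumTo n _ _ ⟩
      sumTo n (λ k → ι (fact n) * (eλm1 l k * spow L k n))   ≈⟨ sumTo-cong n term ⟩
      sumTo n (λ k → S1 l n k * dfall 1# l k)                 ≈⟨ sym (Stirling1.dfall-expansion 1# n) ⟩
      fall 1# n                                              ∎
      where
      n = suc m
      term : ∀ k → ι (fact n) * (eλm1 l k * spow L k n) ≈ S1 l n k * dfall 1# l k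
      term zero    = trans (*-congˡ (zeroˡ _)) (trans (zeroʳ _) (sym (trans (*-congʳ (trans (*-congˡ (zeroˡ _)) (zeroʳ _))) (zeroˡ _))))
      term (suc k) = solve 4 (λ f d i x → f :* (d :* i :* x) := f :* (x :* i) :* d)
                       refl (ι (fact n)) (dfall 1# l (suc k)) (inv _ (charZero (fact (suc k) ∸ 1))) (spow L (suc k) n)

    eλ-1∘L : eλm1 l ∘ˢ L ≋ linear 0# 1#
    eλ-1∘L zero          = zeroˡ _
    eλ-1∘L (suc zero)    = begin
      (eλm1 l ∘ˢ L) 1                 ≈⟨ /fact-unique 1 (trans (*-comm _ _) (fact*[eλ-1∘L]≈fall1 0)) ⟩
      fall 1# 1 /fact 1               ≈⟨ solve 1 (λ i → con 1ℤ :* (con 1ℤ :- con 0ℤ :* con 1ℤ) :* i := con 1ℤ :* i) refl _ ⟩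
      1# /suc 0                       ≈⟨ /suc-zero 1# ⟩
      1#                              ∎
    eλ-1∘L (suc (suc m)) = begin
      (eλm1 l ∘ˢ L) (suc (suc m))     ≈⟨ /fact-unique (suc (suc m)) (trans (*-comm _ _) (fact*[eλ-1∘L]≈fall1 (suc m))) ⟩
      fall 1# (suc (suc m)) /fact (suc (suc m)) ≈⟨ trans (*-congʳ fall-1-vanishes) (zeroˡ _) ⟩
      0#                              ∎
      where
      fall-1-vanishes : fall 1# (suc (suc m)) ≈ 0#
      fall-1-vanishes = trans (dfall-cong 1# (suc (suc m)) (sym (trans (*-congʳ (+-identityʳ 1#)) (*-identityˡ 1#))))
                              (dfall-root 1# (s≤s (z≤n {m})))

    module _ (β : ℕ → Carrier) (isβ : IsDegBernoulli l β) where

      B : Series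
      B k = β k /fact k

      eλ-1⋆B : eλm1 l ⋆ B ≋ linear 0# 1#
      eλ-1⋆B zero          = isβ 0
      eλ-1⋆B (suc zero)    = isβ 1
      eλ-1⋆B (suc (suc n)) = isβ (suc (suc n))

      B∘L : ∀ n → (B ∘ˢ L) n ≈ L (suc n)
      B∘L n = begin
        (B ∘ˢ L) n                                   ≈⟨ sym (t-⋆ (B ∘ˢ L) n) ⟩
        (linear 0# 1# ⋆ (B ∘ˢ L)) (suc n)            ≈⟨ sym (⋆-congʳ (B ∘ˢ L) eλ-1∘L (suc n)) ⟩
        ((eλm1 l ∘ˢ L) ⋆ (B ∘ˢ L)) (suc n)           ≈⟨ sym (∘ˢ-⋆ refl (eλm1 l) B (suc n)) ⟩
        ((eλm1 l ⋆ B) ∘ˢ L) (suc n)                  ≈⟨ ∘ˢ-cong L eλ-1⋆B (suc n) ⟩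
        (linear 0# 1# ∘ˢ L) (suc n)                  ≈⟨ t-∘ˢ refl (suc n) ⟩
        L (suc n)                                    ∎

      S1-bernoulli : ∀ n → sumTo n (λ k → S1 l n k * β k) ≈ (sgn n * fall (ι n - l) n) /suc n
      S1-bernoulli n = begin
        sumTo n (λ k → S1 l n k * β k)
          ≈⟨ sumTo-cong n (λ k → solve 4 (λ f x w b → f :* (x :* w) :* b := f :* (b :* w :* x)) refl
               (ι (fact n)) (spow L k n) (inv _ (charZero (fact k ∸ 1))) (β k)) ⟩
        sumTo n (λ k → ι (fact n) * (B k * spow L k n))     ≈⟨ sym (*-distribˡ-sumTo n _ _) ⟩
        ι (fact n) * (B ∘ˢ L) n                              ≈⟨ *-congˡ (B∘L n) ⟩
        ι (fact n) * ((sgn n * (Fₙ /fact n)) /suc n)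
          ≈⟨ solve 4 (λ f s x i → f :* ((s :* x) :* i) := (s :* (x :* f)) :* i) refl (ι (fact n)) (sgn n) (Fₙ /fact n) _ ⟩
        (sgn n * ((Fₙ /fact n) * ι (fact n))) /suc n          ≈⟨ *-congʳ (*-congˡ (/fact-inverseʳ Fₙ n)) ⟩
        (sgn n * Fₙ) /suc n                                   ∎
        where Fₙ = fall (ι n - l) n

    S1-interchange : ∀ n (a f : ℕ → Carrier) →
      sumTo n (λ j → sumTo n (λ k → a k * S1 l k j) * f j) ≈ sumTo n (λ k → a k * sumTo k (λ j → S1 l k j * f j))
    S1-interchange n a f = begin
      sumTo n (λ j → sumTo n (λ k → a k * S1 l k j) * f j)
        ≈⟨ sumTo-cong n (λ j → trans (*-distribʳ-sumTo n _ _) (sumTo-cong n (λ k → *-assoc _ _ _))) ⟩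
      sumTo n (λ j → sumTo n (λ k → a k * (S1 l k j * f j)))     ≈⟨ sumTo-comm n n _ ⟩
      sumTo n (λ k → sumTo n (λ j → a k * (S1 l k j * f j)))     ≈⟨ sumTo-cong n (λ k → sym (*-distribˡ-sumTo n _ _)) ⟩
      sumTo n (λ k → a k * sumTo n (λ j → S1 l k j * f j))
        ≈⟨ sumTo-cong-≤ n (λ k k≤n → *-congˡ (sumTo-extend _ k≤n (λ j k<j → trans (*-congʳ (Stirling1.A-vanish k<j)) (zeroˡ _)))) ⟩
      sumTo n (λ k → a k * sumTo k (λ j → S1 l k j * f j))       ∎

    module _ (l≉0 : ¬ (l ≈ 0#)) (S2 : ℕ → ℕ → Carrier) (isS2 : IsDegStirling2 l S2) where

      S2-S1-inverse : ∀ n j → j ≤ n → sumTo n (λ k → S2 n k * S1 l k j) ≈ δ n j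
      S2-S1-inverse n = dfall-unique l≉0 n _ (δ n) (λ x → begin
        sumTo n (λ j → sumTo n (λ k → S2 n k * S1 l k j) * dfall x l j)   ≈⟨ S1-interchange n (S2 n) (dfall x l) ⟩
        sumTo n (λ k → S2 n k * sumTo k (λ j → S1 l k j * dfall x l j))
          ≈⟨ sumTo-cong n (λ k → *-congˡ (sym (Stirling1.dfall-expansion x k))) ⟩
        sumTo n (λ k → S2 n k * fall x k)                                 ≈⟨ sym (isS2 n x) ⟩
        dfall x l n                                                       ≈⟨ sym (sumTo-δ n (dfall x l)) ⟩
        sumTo n (λ j → δ n j * dfall x l j)                               ∎)

      S2-bernoulli : (β : ℕ → Carrier) → IsDegBernoulli l β →
        ∀ n → sumTo n (λ k → (sgn k * ι (fact k) * S2 n k * binomλ l k) /suc k) ≈ β n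
      S2-bernoulli β isβ n = begin
        sumTo n (λ k → (sgn k * ι (fact k) * S2 n k * binomλ l k) /suc k)
          ≈⟨ sumTo-cong n (λ k → begin
               (sgn k * ι (fact k) * S2 n k * binomλ l k) /suc k
                 ≈⟨ solve 5 (λ s f s₂ x i → (s :* f :* s₂ :* x) :* i := s₂ :* ((s :* (x :* f)) :* i)) refl
                      (sgn k) (ι (fact k)) (S2 n k) (binomλ l k) (inv _ (charZero k)) ⟩
               S2 n k * ((sgn k * (binomλ l k * ι (fact k))) /suc k)
                 ≈⟨ *-congˡ (*-congʳ (*-congˡ (/fact-inverseʳ _ k))) ⟩
               S2 n k * ((sgn k * fall (ι k - l) k) /suc k)
                 ≈⟨ *-congˡ (sym (S1-bernoulli β isβ k)) ⟩
               S2 n k * sumTo k (λ j → S1 l k j * β j) ∎) ⟩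
        sumTo n (λ k → S2 n k * sumTo k (λ j → S1 l k j * β j))          ≈⟨ sym (S1-interchange n (S2 n) β) ⟩
        sumTo n (λ j → sumTo n (λ k → S2 n k * S1 l k j) * β j)          ≈⟨ sumTo-cong-≤ n (λ j j≤n → *-congʳ (S2-S1-inverse n j j≤n)) ⟩
        sumTo n (λ j → δ n j * β j)                                      ≈⟨ sumTo-δ n β ⟩
        β n                                                              ∎

theorem2p5 : ∀ {c ℓ : Level} (F : CharZeroField c ℓ) → let open CZF F in
    (l : Carrier) → ¬ (l ≈ 0#) →
    (S2 : ℕ → ℕ → Carrier) → IsDegStirling2 l S2 →
    (β : ℕ → Carrier) → IsDegBernoulli l β →
    (∀ n → (amat l n 0 ≈ sumTo n (λ k → (sgn k * ι (fact k) * S2 n k * binomλ l k) /suc k))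
         × (sumTo n (λ k → (sgn k * ι (fact k) * S2 n k * binomλ l k) /suc k) ≈ β n))
    × (∀ n → sumTo n (λ k → S1 l n k * β k) ≈ (sgn n * fall (ι n - l) n) /suc n)
theorem2p5 F l l≉0 S2 isS2 β isβ =
  (λ n → amat-first-column S2 isS2 n , S2-bernoulli l≉0 S2 isS2 β isβ n) , S1-bernoulli β isβ
  where open Degenerate F l
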